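{- Let $m$ be a positive integer such that $m=a^2+b^2+c^2$ for some integers $a,b,c$. If $m\notin\{1,2,3,14\}$, then there are integers $x,y,z$ such that $x^2+y^2+z^2=9m$, $xyz\not\equiv 0\pmod 3$, and $(x^2-1)(y^2-1)(z^2-1)\neq 0$. -}

module Defs where

-- If m = a² + b² + c² with a, b, c not all divisible by 3, sort the triple as a ≥ b ≥ c ≥ 0. The map
-- R(a, b, c) = (a + 2b + 2c, 2a + b − 2c, 2a − 2b + c) multiplies a² + b² + c² by 9, and its three
-- coordinates agree up to sign modulo 3; so R(a, ±b, ±c) is a solution as soon as its first
-- coordinate is prime to 3 and no coordinate is ±1, which is what (x² − 1)(y² − 1)(z² − 1) ≠ 0 says.
-- Any three of the four first coordinates determine a, b and c modulo 3, so at least two sign choices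
-- are prime to 3. For a ≥ 2 only a few coordinates can be ±1, and each such coincidence either
-- contradicts the ordering or pins m down to one of three one-parameter families, which are solved by
-- explicit triples that are linear in the parameter. If 3 divides a, b and c, then m = 9m′ and a
-- solution for m′ is a representation of m of the first kind; the excluded m′ ∈ {1, 2, 3, 14} give
-- m ∈ {9, 18, 27, 126}, which are solved directly.
module Submission where

open import Defs
open import Data.Integer using (ℤ; +_; _+_; _*_; _-_; _<_)
open import Data.Integer.Divisibility using (_∣_)
open import Data.Product using (Σ; ∃-syntax; _×_)
open import Relation.Binary.PropositionalEquality using (_≡_; _≢_)
open import Relation.Nullary using (¬_)

open import Data.Empty using (⊥; ⊥-elim)
open import Data.Integer using (-_; -[1+_]; ∣_∣; _≟_)
open import Data.Integer.Divisibility.Signed as Signed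
  using (divides) renaming (_∣_ to _∣ₛ_; _∣?_ to _∣ₛ?_)
import Data.Integer.Properties as ℤ
open import Data.Integer.Tactic.RingSolver using (solve; solve-∀)
open import Data.List using (_∷_; [])
open import Data.Nat using (ℕ; zero; suc)
import Data.Nat as ℕ
import Data.Nat.Divisibility as ℕ
open import Data.Nat.Induction using (<-rec)
open import Data.Nat.Primality using (Prime; euclidsLemma; prime?)
import Data.Nat.Properties as ℕ
open import Data.Nat.Tactic.RingSolver using () renaming (solve-∀ to ℕ-solve-∀)
open import Data.Product using (_,_)
open import Data.Sum as Sum using (_⊎_; inj₁; inj₂; [_,_]′)
open import Function using (_∘_; id)
open import Relation.Binary.PropositionalEquality
  using (refl; sym; trans; cong; cong₂; subst; subst₂; module ≡-Reasoning)
open import Relation.Nullary using (Dec; yes; no)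
open import Relation.Nullary.Decidable
  using (False; from-yes; from-no; toWitnessFalse; _⊎-dec_; _×-dec_)
open ≡-Reasoning

cong₃ : ∀ {A B C D : Set} (f : A → B → C → D) {x y z u v w} →
        x ≡ u → y ≡ v → z ≡ w → f x y z ≡ f u v w
cong₃ f refl refl refl = refl

x+k≡y⇒x≡y-k : ∀ {x y} k → x + k ≡ y → x ≡ y - k
x+k≡y⇒x≡y-k {x} k x+k≡y = trans x≡x+k-k (cong (_- k) x+k≡y)
  where
  x≡x+k-k : x ≡ x + k - k
  x≡x+k-k = solve (x ∷ k ∷ [])

i≢0∧j≢0⇒i*j≢0 : ∀ {i j} → i ≢ + 0 → j ≢ + 0 → i * j ≢ + 0
i≢0∧j≢0⇒i*j≢0 {i} i≢0 j≢0 = [ i≢0 , j≢0 ]′ ∘ ℤ.i*j≡0⇒i≡0∨j≡0 i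

IsUnit : ℤ → Set
IsUnit x = x ≡ + 1 ⊎ x ≡ - + 1

isUnit? : ∀ x → Dec (IsUnit x)
isUnit? x = x ≟ + 1 ⊎-dec x ≟ - + 1

x²-1≢0 : ∀ {x} → ¬ IsUnit x → x * x - + 1 ≢ + 0
x²-1≢0 {x} ¬unit =
  ¬unit ∘ Sum.map (ℤ.i-j≡0⇒i≡j x (+ 1)) (ℤ.i-j≡0⇒i≡j x (- + 1))
    ∘ ℤ.i*j≡0⇒i≡0∨j≡0 (x - + 1) ∘ trans factor
  where
  factor : (x - + 1) * (x - - + 1) ≡ x * x - + 1
  factor = solve (x ∷ [])

nonUnit-≥2 : ∀ {x} n → x ≡ + 2 + + n → ¬ IsUnit x
nonUnit-≥2 n refl = [ (λ ()) , (λ ()) ]′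

nonUnit-≤-2 : ∀ {x} n → x ≡ - (+ 2 + + n) → ¬ IsUnit x
nonUnit-≤-2 n refl = [ (λ ()) , (λ ()) ]′

+≢-[1+] : ∀ {n k} → + n ≢ -[1+ k ]
+≢-[1+] ()

≢-multiple : ∀ k q {r} → {False (k ∣ₛ? r)} → k * q ≢ r
≢-multiple k q {r} {k∤r} kq≡r = toWitnessFalse k∤r (divides q (trans (sym kq≡r) (ℤ.*-comm k q)))

≢-affine : ∀ k q b {r} → {False (k ∣ₛ? (r - b))} → k * q + b ≢ r
≢-affine k q b {r} {k∤r-b} = ≢-multiple k q {r - b} {k∤r-b} ∘ x+k≡y⇒x≡y-k b

nonUnit-affine : ∀ k q b → {False (k ∣ₛ? (+ 1 - b))} → {False (k ∣ₛ? (- + 1 - b))} →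
                 ¬ IsUnit (k * q + b)
nonUnit-affine k q b {k∤1-b} {k∤-1-b} =
  [ ≢-affine k q b {+ 1} {k∤1-b} , ≢-affine k q b {r = - + 1} {k∤-1-b} ]′

affine-≢-offset : ∀ k q b → k ≢ + 0 → q ≢ + 0 → k * q + b ≢ b
affine-≢-offset k q b k≢0 q≢0 =
  i≢0∧j≢0⇒i*j≢0 k≢0 q≢0 ∘ (λ kq≡b-b → trans kq≡b-b (ℤ.+-inverseʳ b)) ∘ x+k≡y⇒x≡y-k b

p∣i*j⇒p∣i⊎p∣j : ∀ {p} → Prime p → ∀ i j → + p ∣ₛ i * j → + p ∣ₛ i ⊎ + p ∣ₛ j
p∣i*j⇒p∣i⊎p∣j {p} p-prime i j p∣ij =
  Sum.map Signed.∣ᵤ⇒∣ Signed.∣ᵤ⇒∣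
    (euclidsLemma ∣ i ∣ ∣ j ∣ p-prime (subst (p ℕ.∣_) (ℤ.abs-* i j) (Signed.∣⇒∣ᵤ p∣ij)))

3∣i*j⇒3∣i⊎3∣j : ∀ i j → + 3 ∣ₛ i * j → + 3 ∣ₛ i ⊎ + 3 ∣ₛ j
3∣i*j⇒3∣i⊎3∣j = p∣i*j⇒p∣i⊎p∣j (from-yes (prime? 3))

3∤i∧3∤j⇒3∤i*j : ∀ i j → ¬ + 3 ∣ₛ i → ¬ + 3 ∣ₛ j → ¬ + 3 ∣ₛ i * j
3∤i∧3∤j⇒3∤i*j i j 3∤i 3∤j = [ 3∤i , 3∤j ]′ ∘ 3∣i*j⇒3∣i⊎3∣j i j

3∣-shift : ∀ {x} y k → + 3 ∣ₛ x → y ≡ x + + 3 * k → + 3 ∣ₛ y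
3∣-shift y k 3∣x y≡x+3k =
  subst (+ 3 ∣ₛ_) (sym y≡x+3k) (Signed.∣m∣n⇒∣m+n 3∣x (Signed.∣m⇒∣m*n k Signed.∣-refl))

3∣-cancel : ∀ {x y} → + 3 ∣ₛ x → + 3 ∣ₛ y → ∀ k v → x + y ≡ k * v → {False (+ 3 ∣ₛ? k)} →
            + 3 ∣ₛ v
3∣-cancel 3∣x 3∣y k v x+y≡kv {3∤k} =
  [ ⊥-elim ∘ toWitnessFalse 3∤k , id ]′
    (3∣i*j⇒3∣i⊎3∣j k v (subst (+ 3 ∣ₛ_) x+y≡kv (Signed.∣m∣n⇒∣m+n 3∣x 3∣y)))

3∣q+1⇒3∤q-1 : ∀ q → + 3 ∣ₛ q + + 1 → ¬ + 3 ∣ₛ q - + 1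
3∣q+1⇒3∤q-1 q 3∣q+1 3∣q-1 =
  from-no (+ 3 ∣ₛ? + 2) (subst (+ 3 ∣ₛ_) difference (Signed.∣m∣n⇒∣m-n 3∣q+1 3∣q-1))
  where
  difference : q + + 1 - (q - + 1) ≡ + 2
  difference = solve (q ∷ [])

_≡±_ : ℤ → ℤ → Set
x ≡± t = + 3 ∣ₛ x - t ⊎ + 3 ∣ₛ x + t

≡±-refl : ∀ x → x ≡± x
≡±-refl x = inj₁ (divides (+ 0) (solve (x ∷ [])))

3∤-resp-≡± : ∀ {x t} → x ≡± t → ¬ + 3 ∣ₛ t → ¬ + 3 ∣ₛ x
3∤-resp-≡± {t = t} (inj₁ 3∣x-t) 3∤t 3∣x =
  3∤t (subst (+ 3 ∣ₛ_) (ℤ.neg-involutive t) (Signed.∣m⇒∣-m (Signed.∣m+n∣m⇒∣n 3∣x-t 3∣x)))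
3∤-resp-≡± (inj₂ 3∣x+t) 3∤t 3∣x = 3∤t (Signed.∣m+n∣m⇒∣n 3∣x+t 3∣x)

Solution : ℤ → Set
Solution m = ∃[ x ] ∃[ y ] ∃[ z ]
      (x * x + y * y + z * z ≡ + 9 * m)
      × ¬ (+ 3 ∣ x * y * z)
      × ((x * x - + 1) * (y * y - + 1) * (z * z - + 1) ≢ + 0)

solution : ∀ m t x y z → x * x + y * y + z * z ≡ + 9 * m → ¬ + 3 ∣ₛ t →
           x ≡± t → y ≡± t → z ≡± t → ¬ IsUnit x → ¬ IsUnit y → ¬ IsUnit z → Solution m
solution m t x y z sum 3∤t x≡±t y≡±t z≡±t ¬ux ¬uy ¬uz =
  x , y , z , sum , 3∤xyz ∘ Signed.∣ᵤ⇒∣ {i = x * y * z} ,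
  i≢0∧j≢0⇒i*j≢0 (i≢0∧j≢0⇒i*j≢0 (x²-1≢0 ¬ux) (x²-1≢0 ¬uy)) (x²-1≢0 ¬uz)
  where
  3∤xyz : ¬ + 3 ∣ₛ x * y * z
  3∤xyz = 3∤i∧3∤j⇒3∤i*j (x * y) z
    (3∤i∧3∤j⇒3∤i*j x y (3∤-resp-≡± x≡±t 3∤t) (3∤-resp-≡± y≡±t 3∤t)) (3∤-resp-≡± z≡±t 3∤t)

-- INLINE lets the ring solver see through these abbreviations.
rx ry rz : ℤ → ℤ → ℤ → ℤ
rx a b c = a + + 2 * b + + 2 * c
ry a b c = + 2 * a + b - + 2 * c
rz a b c = + 2 * a - + 2 * b + c
{-# INLINE rx #-}
{-# INLINE ry #-}
{-# INLINE rz #-}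

rotation : ∀ m a b c → m ≡ a * a + b * b + c * c → ¬ + 3 ∣ₛ rx a b c →
           ¬ IsUnit (rx a b c) → ¬ IsUnit (ry a b c) → ¬ IsUnit (rz a b c) → Solution m
rotation m a b c m≡a²+b²+c² 3∤x =
  solution m (rx a b c) (rx a b c) (ry a b c) (rz a b c)
    (trans nine-times (cong (+ 9 *_) (sym m≡a²+b²+c²))) 3∤x (≡±-refl (rx a b c))
    (inj₂ (divides (a + b) (solve (a ∷ b ∷ c ∷ []))))
    (inj₂ (divides (a + c) (solve (a ∷ b ∷ c ∷ []))))
  where
  nine-times : rx a b c * rx a b c + ry a b c * ry a b c + rz a b c * rz a b c
             ≡ + 9 * (a * a + b * b + c * c)
  nine-times = solve (a ∷ b ∷ c ∷ [])

-- The sums of squares on which all four sign choices in R(a, ±b, ±c) can fail.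
family₁ family₂ family₃ : ℤ → ℤ
family₁ q = (+ 6 * q - + 1) * (+ 6 * q - + 1) + (+ 3 * q - + 1) * (+ 3 * q - + 1)
family₂ q = (+ 9 * q) * (+ 9 * q) + (+ 6 * q + + 1) * (+ 6 * q + + 1)
          + (+ 6 * q - + 1) * (+ 6 * q - + 1)
family₃ q = (+ 18 * q - + 3) * (+ 18 * q - + 3) + (+ 15 * q - + 2) * (+ 15 * q - + 2)
          + (+ 6 * q - + 1) * (+ 6 * q - + 1)
{-# INLINE family₁ #-}
{-# INLINE family₂ #-}
{-# INLINE family₃ #-}

family₁-solution : ∀ q → q ≢ + 0 → Solution (family₁ q)
family₁-solution q q≢0 with + 3 ∣ₛ? q
... | no 3∤q = solution (family₁ q) q (- + 17 * q + + 3) (- + 10 * q + + 3) (- + 4 * q)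
  (solve (q ∷ [])) 3∤q
  (inj₁ (divides (- + 6 * q + + 1) (solve (q ∷ []))))
  (inj₂ (divides (- + 3 * q + + 1) (solve (q ∷ []))))
  (inj₂ (divides (- q) (solve (q ∷ []))))
  (nonUnit-affine (- + 17) q (+ 3))
  (nonUnit-affine (- + 10) q (+ 3))
  [ ≢-multiple (- + 4) q , ≢-multiple (- + 4) q ]′
... | yes (divides u refl) =
  solution (family₁ (u * + 3)) (+ 1) (- + 60 * u + + 4) (- + 6 * u + + 1) (- + 3 * u - + 1)
  (solve (u ∷ [])) (from-no (+ 3 ∣ₛ? + 1))
  (inj₁ (divides (- + 20 * u + + 1) (solve (u ∷ []))))
  (inj₁ (divides (- + 2 * u) (solve (u ∷ []))))
  (inj₂ (divides (- u) (solve (u ∷ []))))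
  (nonUnit-affine (- + 60) u (+ 4))
  [ affine-≢-offset (- + 6) u (+ 1) (λ ()) u≢0 , ≢-affine (- + 6) u (+ 1) ]′
  [ ≢-affine (- + 3) u (- + 1) , affine-≢-offset (- + 3) u (- + 1) (λ ()) u≢0 ]′
  where
  u≢0 : u ≢ + 0
  u≢0 u≡0 = q≢0 (cong (_* + 3) u≡0)

family₂-solution : ∀ q → q ≢ + 0 → Solution (family₂ q)
family₂-solution q q≢0 with + 3 ∣ₛ? q - + 1
... | no 3∤q-1 =
  solution (family₂ q) (q - + 1) (- + 34 * q + + 1) (- + 11 * q - + 4) (- + 10 * q + + 1)
  (solve (q ∷ [])) 3∤q-1
  (inj₂ (divides (- + 11 * q) (solve (q ∷ []))))
  (inj₁ (divides (- + 4 * q - + 1) (solve (q ∷ []))))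
  (inj₂ (divides (- + 3 * q) (solve (q ∷ []))))
  [ affine-≢-offset (- + 34) q (+ 1) (λ ()) q≢0 , ≢-affine (- + 34) q (+ 1) ]′
  (nonUnit-affine (- + 11) q (- + 4))
  [ affine-≢-offset (- + 10) q (+ 1) (λ ()) q≢0 , ≢-affine (- + 10) q (+ 1) ]′
... | yes 3∣q-1 =
  solution (family₂ q) (q + + 1) (+ 34 * q + + 1) (+ 11 * q - + 4) (+ 10 * q + + 1)
  (solve (q ∷ [])) (λ 3∣q+1 → 3∣q+1⇒3∤q-1 q 3∣q+1 3∣q-1)
  (inj₁ (divides (+ 11 * q) (solve (q ∷ []))))
  (inj₂ (divides (+ 4 * q - + 1) (solve (q ∷ []))))
  (inj₁ (divides (+ 3 * q) (solve (q ∷ []))))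
  [ affine-≢-offset (+ 34) q (+ 1) (λ ()) q≢0 , ≢-affine (+ 34) q (+ 1) ]′
  (nonUnit-affine (+ 11) q (- + 4))
  [ affine-≢-offset (+ 10) q (+ 1) (λ ()) q≢0 , ≢-affine (+ 10) q (+ 1) ]′

family₃-solution : ∀ q → q ≢ + 0 → Solution (family₃ q)
family₃-solution q q≢0 with + 3 ∣ₛ? q + + 1
... | no 3∤q+1 =
  solution (family₃ q) (q + + 1) (- + 70 * q + + 11) (- + 14 * q + + 1) (- + 13 * q + + 2)
  (solve (q ∷ [])) 3∤q+1
  (inj₂ (divides (- + 23 * q + + 4) (solve (q ∷ []))))
  (inj₁ (divides (- + 5 * q) (solve (q ∷ []))))
  (inj₂ (divides (- + 4 * q + + 1) (solve (q ∷ []))))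
  (nonUnit-affine (- + 70) q (+ 11))
  [ affine-≢-offset (- + 14) q (+ 1) (λ ()) q≢0 , ≢-affine (- + 14) q (+ 1) ]′
  (nonUnit-affine (- + 13) q (+ 2))
... | yes 3∣q+1 =
  solution (family₃ q) (q - + 1) (- + 67 * q + + 10) (- + 26 * q + + 5) (- + 10 * q + + 1)
  (solve (q ∷ [])) (3∣q+1⇒3∤q-1 q 3∣q+1)
  (inj₂ (divides (- + 22 * q + + 3) (solve (q ∷ []))))
  (inj₁ (divides (- + 9 * q + + 2) (solve (q ∷ []))))
  (inj₂ (divides (- + 3 * q) (solve (q ∷ []))))
  (nonUnit-affine (- + 67) q (+ 10))
  (nonUnit-affine (- + 26) q (+ 5))
  [ affine-≢-offset (- + 10) q (+ 1) (λ ()) q≢0 , ≢-affine (- + 10) q (+ 1) ]′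

-- A triple a ≥ b ≥ c ≥ 0 is given by c and the gaps d = b − c and e = a − b, so that a = c + d + e
-- and b = c + d; xᵢ yᵢ zᵢ are the coordinates of R(a, b, c), R(a, b, −c), R(a, −b, c), R(a, −b, −c).
M : ℤ → ℤ → ℤ → ℤ
M c d e = (c + d + e) * (c + d + e) + (c + d) * (c + d) + c * c
{-# INLINE M #-}

x₁ y₁ z₁ x₂ y₂ z₂ x₃ y₃ z₃ x₄ y₄ z₄ : ℤ → ℤ → ℤ → ℤ
x₁ c d e = rx (c + d + e) (c + d) c
y₁ c d e = ry (c + d + e) (c + d) c
z₁ c d e = rz (c + d + e) (c + d) c
x₂ c d e = rx (c + d + e) (c + d) (- c)
y₂ c d e = ry (c + d + e) (c + d) (- c)
z₂ c d e = rz (c + d + e) (c + d) (- c)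
x₃ c d e = rx (c + d + e) (- (c + d)) c
y₃ c d e = ry (c + d + e) (- (c + d)) c
z₃ c d e = rz (c + d + e) (- (c + d)) c
x₄ c d e = rx (c + d + e) (- (c + d)) (- c)
y₄ c d e = ry (c + d + e) (- (c + d)) (- c)
z₄ c d e = rz (c + d + e) (- (c + d)) (- c)
{-# INLINE x₁ #-}
{-# INLINE y₁ #-}
{-# INLINE z₁ #-}
{-# INLINE x₂ #-}
{-# INLINE y₂ #-}
{-# INLINE z₂ #-}
{-# INLINE x₃ #-}
{-# INLINE y₃ #-}
{-# INLINE z₃ #-}
{-# INLINE x₄ #-}
{-# INLINE y₄ #-}
{-# INLINE z₄ #-}

rotation₁ : ∀ c d e → ¬ + 3 ∣ₛ x₁ c d e →
            ¬ IsUnit (x₁ c d e) → ¬ IsUnit (y₁ c d e) → ¬ IsUnit (z₁ c d e) → Solution (M c d e)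
rotation₁ c d e = rotation (M c d e) (c + d + e) (c + d) c refl

rotation₂ : ∀ c d e → ¬ + 3 ∣ₛ x₂ c d e →
            ¬ IsUnit (x₂ c d e) → ¬ IsUnit (y₂ c d e) → ¬ IsUnit (z₂ c d e) → Solution (M c d e)
rotation₂ c d e = rotation (M c d e) (c + d + e) (c + d) (- c) (solve (c ∷ d ∷ e ∷ []))

rotation₃ : ∀ c d e → ¬ + 3 ∣ₛ x₃ c d e →
            ¬ IsUnit (x₃ c d e) → ¬ IsUnit (y₃ c d e) → ¬ IsUnit (z₃ c d e) → Solution (M c d e)
rotation₃ c d e = rotation (M c d e) (c + d + e) (- (c + d)) c (solve (c ∷ d ∷ e ∷ []))

rotation₄ : ∀ c d e → ¬ + 3 ∣ₛ x₄ c d e →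
            ¬ IsUnit (x₄ c d e) → ¬ IsUnit (y₄ c d e) → ¬ IsUnit (z₄ c d e) → Solution (M c d e)
rotation₄ c d e = rotation (M c d e) (c + d + e) (- (c + d)) (- c) (solve (c ∷ d ∷ e ∷ []))

x₃-x₄≡4c : ∀ c d e → x₃ c d e - x₄ c d e ≡ + 4 * c
x₃-x₄≡4c = solve-∀

c≡2e-z₂ : ∀ c d e → c ≡ + 2 * e - z₂ c d e
c≡2e-z₂ = solve-∀

d≡y₃-z₂ : ∀ c d e → d ≡ y₃ c d e - z₂ c d e
d≡y₃-z₂ = solve-∀

Imprimitive : ℤ → ℤ → ℤ → Set
Imprimitive c d e = + 3 ∣ₛ c + d + e × + 3 ∣ₛ c + d × + 3 ∣ₛ c

imprimitive₁₂₄ : ∀ c d e → + 3 ∣ₛ x₁ c d e → + 3 ∣ₛ x₂ c d e → + 3 ∣ₛ x₄ c d e → Imprimitive c d e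
imprimitive₁₂₄ c d e 3∣x₁ 3∣x₂ 3∣x₄ =
  3∣-cancel 3∣x₁ 3∣x₄ (+ 2) (c + d + e) (solve (c ∷ d ∷ e ∷ [])) ,
  3∣-cancel 3∣x₂ (Signed.∣m⇒∣-m 3∣x₄) (+ 4) (c + d) (solve (c ∷ d ∷ e ∷ [])) ,
  3∣-cancel 3∣x₁ (Signed.∣m⇒∣-m 3∣x₂) (+ 4) c (solve (c ∷ d ∷ e ∷ []))

imprimitive₁₃₄ : ∀ c d e → + 3 ∣ₛ x₁ c d e → + 3 ∣ₛ x₃ c d e → + 3 ∣ₛ x₄ c d e → Imprimitive c d e
imprimitive₁₃₄ c d e 3∣x₁ 3∣x₃ 3∣x₄ =
  3∣-cancel 3∣x₁ 3∣x₄ (+ 2) (c + d + e) (solve (c ∷ d ∷ e ∷ [])) ,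
  3∣-cancel 3∣x₁ (Signed.∣m⇒∣-m 3∣x₃) (+ 4) (c + d) (solve (c ∷ d ∷ e ∷ [])) ,
  3∣-cancel 3∣x₃ (Signed.∣m⇒∣-m 3∣x₄) (+ 4) c (x₃-x₄≡4c c d e)

imprimitive₁₂₃ : ∀ c d e → + 3 ∣ₛ x₁ c d e → + 3 ∣ₛ x₂ c d e → + 3 ∣ₛ x₃ c d e → Imprimitive c d e
imprimitive₁₂₃ c d e 3∣x₁ 3∣x₂ 3∣x₃ =
  3∣-cancel 3∣x₂ 3∣x₃ (+ 2) (c + d + e) (solve (c ∷ d ∷ e ∷ [])) ,
  3∣-cancel 3∣x₁ (Signed.∣m⇒∣-m 3∣x₃) (+ 4) (c + d) (solve (c ∷ d ∷ e ∷ [])) ,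
  3∣-cancel 3∣x₁ (Signed.∣m⇒∣-m 3∣x₂) (+ 4) c (solve (c ∷ d ∷ e ∷ []))

3∣z₂-x₃ : ∀ c d e → + 3 ∣ₛ x₁ c d e → + 3 ∣ₛ x₄ c d e → + 3 ∣ₛ z₂ c d e - x₃ c d e
3∣z₂-x₃ c d e 3∣x₁ 3∣x₄ = 3∣-shift (z₂ c d e - x₃ c d e) (d + e)
  (Signed.∣m⇒∣-m (Signed.∣m∣n⇒∣m+n 3∣x₁ 3∣x₄)) (solve (c ∷ d ∷ e ∷ []))

3∣z₂+y₃ : ∀ c d e → + 3 ∣ₛ x₁ c d e → + 3 ∣ₛ x₄ c d e → + 3 ∣ₛ z₂ c d e + y₃ c d e
3∣z₂+y₃ c d e 3∣x₁ 3∣x₄ = 3∣-shift (z₂ c d e + y₃ c d e) (d + + 2 * e)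
  (Signed.∣m⇒∣-m (Signed.∣m∣n⇒∣m+n 3∣x₁ 3∣x₄)) (solve (c ∷ d ∷ e ∷ []))

family₁-case⁺ : ∀ c d e → x₃ c d e ≡ + 1 → x₄ c d e ≡ + 1 → + 3 ∣ₛ x₁ c d e → M c d e ≢ + 2 →
                Solution (M c d e)
family₁-case⁺ c d e x₃≡1 x₄≡1 3∣x₁ ≢2 = from-quotient 3∣d+1
  where
  c≡0 : c ≡ + 0
  c≡0 = ℤ.*-cancelˡ-≡ (+ 4) c (+ 0) (trans (sym (x₃-x₄≡4c c d e)) (cong₂ _-_ x₃≡1 x₄≡1))
  e≡x₄+3c+d : e ≡ x₄ c d e + + 3 * c + d
  e≡x₄+3c+d = solve (c ∷ d ∷ e ∷ [])
  e≡1+d : e ≡ + 1 + d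
  e≡1+d = trans e≡x₄+3c+d (cong₂ (λ x c → x + + 3 * c + d) x₄≡1 c≡0)
  3∣d+1 : + 3 ∣ₛ d + + 1
  3∣d+1 = 3∣-shift (d + + 1) (- d) (subst₂ (λ c e → + 3 ∣ₛ x₁ c d e) c≡0 e≡1+d 3∣x₁) (solve (d ∷ []))
  from-quotient : + 3 ∣ₛ d + + 1 → Solution (M c d e)
  from-quotient (divides q d+1≡3q) = subst Solution (sym M≡) (family₁-solution q q≢0)
    where
    d≡3q-1 : d ≡ q * + 3 - + 1
    d≡3q-1 = x+k≡y⇒x≡y-k (+ 1) d+1≡3q
    M≡ : M c d e ≡ family₁ q
    M≡ = begin
      M c d e                                         ≡⟨ cong₂ (λ c e → M c d e) c≡0 e≡1+d ⟩
      M (+ 0) d (+ 1 + d)                             ≡⟨ cong (λ d → M (+ 0) d (+ 1 + d)) d≡3q-1 ⟩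
      M (+ 0) (q * + 3 - + 1) (+ 1 + (q * + 3 - + 1)) ≡⟨ solve (q ∷ []) ⟩
      family₁ q                                       ∎
    q≢0 : q ≢ + 0
    q≢0 refl = ≢2 M≡

family₂-case : ∀ c d e → z₂ c d e ≡ - + 1 → y₃ c d e ≡ + 1 → + 3 ∣ₛ x₄ c d e → M c d e ≢ + 2 →
               Solution (M c d e)
family₂-case c d e z₂≡-1 y₃≡1 3∣x₄ ≢2 = from-quotient 3∣e+1
  where
  c≡2e+1 : c ≡ + 2 * e + + 1
  c≡2e+1 = trans (c≡2e-z₂ c d e) (cong (λ z → + 2 * e - z) z₂≡-1)
  d≡2 : d ≡ + 2
  d≡2 = trans (d≡y₃-z₂ c d e) (cong₂ _-_ y₃≡1 z₂≡-1)
  3∣e+1 : + 3 ∣ₛ e + + 1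
  3∣e+1 = 3∣-shift (e + + 1) (+ 2 * e + + 2) (subst₂ (λ c d → + 3 ∣ₛ x₄ c d e) c≡2e+1 d≡2 3∣x₄)
            (solve (e ∷ []))
  from-quotient : + 3 ∣ₛ e + + 1 → Solution (M c d e)
  from-quotient (divides q e+1≡3q) = subst Solution (sym M≡) (family₂-solution q q≢0)
    where
    e≡3q-1 : e ≡ q * + 3 - + 1
    e≡3q-1 = x+k≡y⇒x≡y-k (+ 1) e+1≡3q
    M≡ : M c d e ≡ family₂ q
    M≡ = begin
      M c d e                         ≡⟨ cong₂ (λ c d → M c d e) c≡2e+1 d≡2 ⟩
      M (+ 2 * e + + 1) (+ 2) e       ≡⟨ cong (λ e → M (+ 2 * e + + 1) (+ 2) e) e≡3q-1 ⟩
      M (+ 2 * (q * + 3 - + 1) + + 1) (+ 2) (q * + 3 - + 1)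
                                      ≡⟨ solve (q ∷ []) ⟩
      family₂ q                       ∎
    q≢0 : q ≢ + 0
    q≢0 refl = ≢2 M≡

family₃-case⁻ : ∀ c d e → z₂ c d e ≡ - + 1 → x₃ c d e ≡ - + 1 → + 3 ∣ₛ x₄ c d e → M c d e ≢ + 14 →
                Solution (M c d e)
family₃-case⁻ c d e z₂≡-1 x₃≡-1 3∣x₄ ≢14 = from-quotient 3∣e+1
  where
  c≡2e+1 : c ≡ + 2 * e + + 1
  c≡2e+1 = trans (c≡2e-z₂ c d e) (cong (λ z → + 2 * e - z) z₂≡-1)
  d≡3e-z₂-x₃ : d ≡ + 3 * e - z₂ c d e - x₃ c d e
  d≡3e-z₂-x₃ = solve (c ∷ d ∷ e ∷ [])
  d≡3e+2 : d ≡ + 3 * e + + 1 + + 1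
  d≡3e+2 = trans d≡3e-z₂-x₃ (cong₂ (λ z x → + 3 * e - z - x) z₂≡-1 x₃≡-1)
  3∣e+1 : + 3 ∣ₛ e + + 1
  3∣e+1 = 3∣-shift (e + + 1) (+ 3 * e + + 2) (subst₂ (λ c d → + 3 ∣ₛ x₄ c d e) c≡2e+1 d≡3e+2 3∣x₄)
            (solve (e ∷ []))
  from-quotient : + 3 ∣ₛ e + + 1 → Solution (M c d e)
  from-quotient (divides q e+1≡3q) = subst Solution (sym M≡) (family₃-solution q q≢0)
    where
    e≡3q-1 : e ≡ q * + 3 - + 1
    e≡3q-1 = x+k≡y⇒x≡y-k (+ 1) e+1≡3q
    M≡ : M c d e ≡ family₃ q
    M≡ = begin
      M c d e                                   ≡⟨ cong₂ (λ c d → M c d e) c≡2e+1 d≡3e+2 ⟩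
      M (+ 2 * e + + 1) (+ 3 * e + + 1 + + 1) e
        ≡⟨ cong (λ e → M (+ 2 * e + + 1) (+ 3 * e + + 1 + + 1) e) e≡3q-1 ⟩
      M (+ 2 * (q * + 3 - + 1) + + 1) (+ 3 * (q * + 3 - + 1) + + 1 + + 1) (q * + 3 - + 1)
        ≡⟨ solve (q ∷ []) ⟩
      family₃ q                                 ∎
    q≢0 : q ≢ + 0
    q≢0 refl = ≢14 M≡

M-neg : ∀ c d e → M (- c) (- d) (- e) ≡ M c d e
M-neg = solve-∀

x₁-neg : ∀ c d e → x₁ (- c) (- d) (- e) ≡ - x₁ c d e
x₁-neg = solve-∀

z₂-neg : ∀ c d e → z₂ (- c) (- d) (- e) ≡ - z₂ c d e
z₂-neg = solve-∀

x₃-neg : ∀ c d e → x₃ (- c) (- d) (- e) ≡ - x₃ c d e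
x₃-neg = solve-∀

x₄-neg : ∀ c d e → x₄ (- c) (- d) (- e) ≡ - x₄ c d e
x₄-neg = solve-∀

family₁-case⁻ : ∀ c d e → x₃ c d e ≡ - + 1 → x₄ c d e ≡ - + 1 → + 3 ∣ₛ x₁ c d e → M c d e ≢ + 2 →
                Solution (M c d e)
family₁-case⁻ c d e x₃≡-1 x₄≡-1 3∣x₁ ≢2 = subst Solution (M-neg c d e)
  (family₁-case⁺ (- c) (- d) (- e)
    (trans (x₃-neg c d e) (cong -_ x₃≡-1)) (trans (x₄-neg c d e) (cong -_ x₄≡-1))
    (subst (+ 3 ∣ₛ_) (sym (x₁-neg c d e)) (Signed.∣m⇒∣-m 3∣x₁)) (≢2 ∘ trans (sym (M-neg c d e))))

family₃-case⁺ : ∀ c d e → z₂ c d e ≡ + 1 → x₃ c d e ≡ + 1 → + 3 ∣ₛ x₄ c d e → M c d e ≢ + 14 →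
                Solution (M c d e)
family₃-case⁺ c d e z₂≡1 x₃≡1 3∣x₄ ≢14 = subst Solution (M-neg c d e)
  (family₃-case⁻ (- c) (- d) (- e)
    (trans (z₂-neg c d e) (cong -_ z₂≡1)) (trans (x₃-neg c d e) (cong -_ x₃≡1))
    (subst (+ 3 ∣ₛ_) (sym (x₄-neg c d e)) (Signed.∣m⇒∣-m 3∣x₄)) (≢14 ∘ trans (sym (M-neg c d e))))

solution-c≡1-e≡0-3∣x₄ : ∀ d → + 3 ∣ₛ x₄ (+ 1) (+ suc d) (+ 0) → Solution (M (+ 1) (+ suc d) (+ 0))
solution-c≡1-e≡0-3∣x₄ zero 3∣x₄ = ⊥-elim (from-no (+ 3 ∣ₛ? - + 4) 3∣x₄)
solution-c≡1-e≡0-3∣x₄ (suc zero) 3∣x₄ = ⊥-elim (from-no (+ 3 ∣ₛ? - + 5) 3∣x₄)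
solution-c≡1-e≡0-3∣x₄ (suc (suc g)) 3∣x₄ =
  rotation₃ (+ 1) (+ 3 + + g) (+ 0) 3∤x₃
    (nonUnit-≤-2 g (x₃≡ (+ g))) (nonUnit-≥2 g (y₃≡ (+ g))) (nonUnit-≥2 _ (z₃≡ (+ g)))
  where
  x₃≡ : ∀ g → x₃ (+ 1) (+ 3 + g) (+ 0) ≡ - (+ 2 + g)
  x₃≡ = solve-∀
  y₃≡ : ∀ g → y₃ (+ 1) (+ 3 + g) (+ 0) ≡ + 2 + g
  y₃≡ = solve-∀
  z₃≡ : ∀ g → z₃ (+ 1) (+ 3 + g) (+ 0) ≡ + 2 + (+ 15 + g + g + g + g)
  z₃≡ = solve-∀
  3∤x₃ : ¬ + 3 ∣ₛ x₃ (+ 1) (+ 3 + + g) (+ 0)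
  3∤x₃ 3∣x₃ = from-no (+ 3 ∣ₛ? + 1)
    (3∣-cancel 3∣x₃ (Signed.∣m⇒∣-m 3∣x₄) (+ 4) (+ 1) (x₃-x₄≡4c (+ 1) (+ 3 + + g) (+ 0)))

solution-c≡1-e≡0 : ∀ d → M (+ 1) (+ d) (+ 0) ≢ + 3 → Solution (M (+ 1) (+ d) (+ 0))
solution-c≡1-e≡0 zero ≢3 = ⊥-elim (≢3 refl)
solution-c≡1-e≡0 (suc d) _ with + 3 ∣ₛ? x₄ (+ 1) (+ suc d) (+ 0)
... | yes 3∣x₄ = solution-c≡1-e≡0-3∣x₄ d 3∣x₄
... | no 3∤x₄ = rotation₄ (+ 1) (+ suc d) (+ 0) 3∤x₄
  (nonUnit-≤-2 _ (x₄≡ (+ d))) (nonUnit-≥2 _ (y₄≡ (+ d))) (nonUnit-≥2 _ (z₄≡ (+ d)))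
  where
  x₄≡ : ∀ d → x₄ (+ 1) (+ 1 + d) (+ 0) ≡ - (+ 2 + (+ 2 + d))
  x₄≡ = solve-∀
  y₄≡ : ∀ d → y₄ (+ 1) (+ 1 + d) (+ 0) ≡ + 2 + (+ 2 + d)
  y₄≡ = solve-∀
  z₄≡ : ∀ d → z₄ (+ 1) (+ 1 + d) (+ 0) ≡ + 2 + (+ 5 + d + d + d + d)
  z₄≡ = solve-∀

c+e+e≡1 : ∀ c e → c ℕ.+ e ℕ.+ e ≡ 1 → c ≡ 1 × e ≡ 0
c+e+e≡1 0 0 ()
c+e+e≡1 0 (suc zero) ()
c+e+e≡1 0 (suc (suc e)) ()
c+e+e≡1 1 0 refl = refl , refl
c+e+e≡1 1 (suc e) ()
c+e+e≡1 (suc (suc c)) e ()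

-- Non-negative combinations of the gaps are written as repeated sums such as c + c + d, which at
-- natural arguments reduce to a literal + n.
module _ {c d e f : ℕ} (a≡2+f : c ℕ.+ d ℕ.+ e ≡ 2 ℕ.+ f) where

  private
    C D E F : ℤ
    C = + c
    D = + d
    E = + e
    F = + f

  a-f≡2 : C + D + E - F ≡ + 2
  a-f≡2 = trans (cong (λ n → + n - F) a≡2+f) (2+f-f F)
    where
    2+f-f : ∀ f → + 2 + f - f ≡ + 2
    2+f-f = solve-∀

  nonUnit-above : ∀ {x} n → x ≡ C + D + E - F + + n → ¬ IsUnit x
  nonUnit-above n x≡ = nonUnit-≥2 n (trans x≡ (cong (_+ + n) a-f≡2))

  -- In each sorted-rotationᵢ the coordinates that are not hypotheses are at least a ≥ 2.
  sorted-rotation₁ : ¬ + 3 ∣ₛ x₁ C D E → ¬ IsUnit (z₁ C D E) → Solution (M C D E)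
  sorted-rotation₁ 3∤x₁ =
    rotation₁ C D E 3∤x₁ (nonUnit-above _ (x₁≡ C D E F)) (nonUnit-above _ (y₁≡ C D E F))
    where
    x₁≡ : ∀ c d e f → x₁ c d e ≡ c + d + e - f + (f + c + c + c + c + d + d)
    x₁≡ = solve-∀
    y₁≡ : ∀ c d e f → y₁ c d e ≡ c + d + e - f + (f + d + d + e)
    y₁≡ = solve-∀

  sorted-rotation₂ : ¬ + 3 ∣ₛ x₂ C D E → ¬ IsUnit (z₂ C D E) → Solution (M C D E)
  sorted-rotation₂ 3∤x₂ =
    rotation₂ C D E 3∤x₂ (nonUnit-above _ (x₂≡ C D E F)) (nonUnit-above _ (y₂≡ C D E F))
    where
    x₂≡ : ∀ c d e f → x₂ c d e ≡ c + d + e - f + (f + d + d)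
    x₂≡ = solve-∀
    y₂≡ : ∀ c d e f → y₂ c d e ≡ c + d + e - f + (f + c + c + c + c + d + d + e)
    y₂≡ = solve-∀

  sorted-rotation₃ : ¬ + 3 ∣ₛ x₃ C D E → ¬ IsUnit (x₃ C D E) → ¬ IsUnit (y₃ C D E) → Solution (M C D E)
  sorted-rotation₃ 3∤x₃ ¬ux ¬uy = rotation₃ C D E 3∤x₃ ¬ux ¬uy (nonUnit-above _ (z₃≡ C D E F))
    where
    z₃≡ : ∀ c d e f → z₃ c d e ≡ c + d + e - f + (f + c + c + c + c + d + d + d + e)
    z₃≡ = solve-∀

  sorted-rotation₄ : ¬ + 3 ∣ₛ x₄ C D E → ¬ IsUnit (x₄ C D E) → Solution (M C D E)
  sorted-rotation₄ 3∤x₄ ¬ux =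
    rotation₄ C D E 3∤x₄ ¬ux (nonUnit-above _ (y₄≡ C D E F)) (nonUnit-above _ (z₄≡ C D E F))
    where
    y₄≡ : ∀ c d e f → y₄ c d e ≡ c + d + e - f + (f + c + c + e)
    y₄≡ = solve-∀
    z₄≡ : ∀ c d e f → z₄ c d e ≡ c + d + e - f + (f + c + c + d + d + d + e)
    z₄≡ = solve-∀

  z₁-unit⇒c≡1∧e≡0 : IsUnit (z₁ C D E) → c ≡ 1 × e ≡ 0
  z₁-unit⇒c≡1∧e≡0 (inj₁ z₁≡1) = c+e+e≡1 c e (ℤ.+-injective (trans (sym (z₁≡ C D E)) z₁≡1))
    where
    z₁≡ : ∀ c d e → z₁ c d e ≡ c + e + e
    z₁≡ = solve-∀
  z₁-unit⇒c≡1∧e≡0 (inj₂ z₁≡-1) = ⊥-elim (+≢-[1+] (trans (sym (z₁≡ C D E)) z₁≡-1))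
    where
    z₁≡ : ∀ c d e → z₁ c d e ≡ c + e + e
    z₁≡ = solve-∀

  solution-3∤x₁ : ¬ + 3 ∣ₛ x₁ C D E → M C D E ≢ + 3 → Solution (M C D E)
  solution-3∤x₁ 3∤x₁ ≢3 with isUnit? (z₁ C D E)
  ... | no ¬u = sorted-rotation₁ 3∤x₁ ¬u
  ... | yes u with z₁-unit⇒c≡1∧e≡0 u
  ...   | c≡1 , e≡0 =
    subst₂ (λ c e → Solution (M (+ c) D (+ e))) (sym c≡1) (sym e≡0)
      (solution-c≡1-e≡0 d (≢3 ∘ subst₂ (λ c e → M (+ c) D (+ e) ≡ + 3) (sym c≡1) (sym e≡0)))

  solution-3∣x₁-3∣x₄ : + 3 ∣ₛ x₁ C D E → + 3 ∣ₛ x₄ C D E → ¬ + 3 ∣ₛ x₂ C D E → ¬ + 3 ∣ₛ x₃ C D E →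
                       M C D E ≢ + 2 → M C D E ≢ + 14 → Solution (M C D E)
  solution-3∣x₁-3∣x₄ 3∣x₁ 3∣x₄ 3∤x₂ 3∤x₃ ≢2 ≢14 with isUnit? (z₂ C D E)
  ... | no ¬u₂ = sorted-rotation₂ 3∤x₂ ¬u₂
  ... | yes u₂ with isUnit? (x₃ C D E) | isUnit? (y₃ C D E)
  ...   | no ¬u₃ | no ¬v₃ = sorted-rotation₃ 3∤x₃ ¬u₃ ¬v₃
  ...   | yes u₃ | _ = z₂x₃-units u₂ u₃
    where
    z₂x₃-units : IsUnit (z₂ C D E) → IsUnit (x₃ C D E) → Solution (M C D E)
    z₂x₃-units (inj₁ z₂≡1) (inj₁ x₃≡1) = family₃-case⁺ C D E z₂≡1 x₃≡1 3∣x₄ ≢14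
    z₂x₃-units (inj₂ z₂≡-1) (inj₂ x₃≡-1) = family₃-case⁻ C D E z₂≡-1 x₃≡-1 3∣x₄ ≢14
    z₂x₃-units (inj₁ z₂≡1) (inj₂ x₃≡-1) = ⊥-elim (from-no (+ 3 ∣ₛ? + 2)
      (subst (+ 3 ∣ₛ_) (cong₂ _-_ z₂≡1 x₃≡-1) (3∣z₂-x₃ C D E 3∣x₁ 3∣x₄)))
    z₂x₃-units (inj₂ z₂≡-1) (inj₁ x₃≡1) = ⊥-elim (from-no (+ 3 ∣ₛ? - + 2)
      (subst (+ 3 ∣ₛ_) (cong₂ _-_ z₂≡-1 x₃≡1) (3∣z₂-x₃ C D E 3∣x₁ 3∣x₄)))
  ...   | no _ | yes v₃ = z₂y₃-units u₂ v₃
    where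
    z₂y₃-units : IsUnit (z₂ C D E) → IsUnit (y₃ C D E) → Solution (M C D E)
    z₂y₃-units (inj₂ z₂≡-1) (inj₁ y₃≡1) = family₂-case C D E z₂≡-1 y₃≡1 3∣x₄ ≢2
    z₂y₃-units (inj₁ z₂≡1) (inj₂ y₃≡-1) =
      ⊥-elim (+≢-[1+] (trans (d≡y₃-z₂ C D E) (cong₂ _-_ y₃≡-1 z₂≡1)))
    z₂y₃-units (inj₁ z₂≡1) (inj₁ y₃≡1) = ⊥-elim (from-no (+ 3 ∣ₛ? + 2)
      (subst (+ 3 ∣ₛ_) (cong₂ _+_ z₂≡1 y₃≡1) (3∣z₂+y₃ C D E 3∣x₁ 3∣x₄)))
    z₂y₃-units (inj₂ z₂≡-1) (inj₂ y₃≡-1) = ⊥-elim (from-no (+ 3 ∣ₛ? - + 2)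
      (subst (+ 3 ∣ₛ_) (cong₂ _+_ z₂≡-1 y₃≡-1) (3∣z₂+y₃ C D E 3∣x₁ 3∣x₄)))

  solution-3∣x₁-3∤x₄-3∤x₃ : + 3 ∣ₛ x₁ C D E → ¬ + 3 ∣ₛ x₄ C D E → ¬ + 3 ∣ₛ x₃ C D E →
                            M C D E ≢ + 2 → Solution (M C D E)
  solution-3∣x₁-3∤x₄-3∤x₃ 3∣x₁ 3∤x₄ 3∤x₃ ≢2 with isUnit? (x₄ C D E)
  ... | no ¬u₄ = sorted-rotation₄ 3∤x₄ ¬u₄
  ... | yes u₄ with isUnit? (x₃ C D E) | isUnit? (y₃ C D E)
  ...   | no ¬u₃ | no ¬v₃ = sorted-rotation₃ 3∤x₃ ¬u₃ ¬v₃
  ...   | yes u₃ | _ = x₄x₃-units u₄ u₃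
    where
    x₄x₃-units : IsUnit (x₄ C D E) → IsUnit (x₃ C D E) → Solution (M C D E)
    x₄x₃-units (inj₁ x₄≡1) (inj₁ x₃≡1) = family₁-case⁺ C D E x₃≡1 x₄≡1 3∣x₁ ≢2
    x₄x₃-units (inj₂ x₄≡-1) (inj₂ x₃≡-1) = family₁-case⁻ C D E x₃≡-1 x₄≡-1 3∣x₁ ≢2
    x₄x₃-units (inj₁ x₄≡1) (inj₂ x₃≡-1) =
      ⊥-elim (≢-multiple (+ 4) C (trans (sym (x₃-x₄≡4c C D E)) (cong₂ _-_ x₃≡-1 x₄≡1)))
    x₄x₃-units (inj₂ x₄≡-1) (inj₁ x₃≡1) =
      ⊥-elim (≢-multiple (+ 4) C (trans (sym (x₃-x₄≡4c C D E)) (cong₂ _-_ x₃≡1 x₄≡-1)))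
  ...   | no _ | yes v₃ = ⊥-elim (x₄y₃-units u₄ v₃)
    where
    certificate : ∀ c d e f → c + d + d + d + e + f + f + f + f
                  ≡ - + 3 * x₄ c d e + + 4 * y₃ c d e - + 4 * (c + d + e - f)
    certificate = solve-∀
    bound : ∀ {u v} → x₄ C D E ≡ u → y₃ C D E ≡ v →
            C + D + D + D + E + F + F + F + F ≡ - + 3 * u + + 4 * v - + 4 * + 2
    bound x₄≡u y₃≡v = trans (certificate C D E F)
      (cong₃ (λ u v w → - + 3 * u + + 4 * v - + 4 * w) x₄≡u y₃≡v a-f≡2)
    x₄y₃-units : IsUnit (x₄ C D E) → IsUnit (y₃ C D E) → ⊥
    x₄y₃-units (inj₁ x₄≡1) (inj₁ y₃≡1) = +≢-[1+] (bound x₄≡1 y₃≡1)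
    x₄y₃-units (inj₁ x₄≡1) (inj₂ y₃≡-1) = +≢-[1+] (bound x₄≡1 y₃≡-1)
    x₄y₃-units (inj₂ x₄≡-1) (inj₁ y₃≡1) = +≢-[1+] (bound x₄≡-1 y₃≡1)
    x₄y₃-units (inj₂ x₄≡-1) (inj₂ y₃≡-1) = +≢-[1+] (bound x₄≡-1 y₃≡-1)

  solution-3∤x₄-3∤x₂ : ¬ + 3 ∣ₛ x₄ C D E → ¬ + 3 ∣ₛ x₂ C D E → Solution (M C D E)
  solution-3∤x₄-3∤x₂ 3∤x₄ 3∤x₂ with isUnit? (x₄ C D E)
  ... | no ¬u₄ = sorted-rotation₄ 3∤x₄ ¬u₄
  ... | yes u₄ with isUnit? (z₂ C D E)
  ...   | no ¬u₂ = sorted-rotation₂ 3∤x₂ ¬u₂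
  ...   | yes u₂ = ⊥-elim (x₄z₂-units u₄ u₂)
    where
    certificate : ∀ c d e f → c + f ≡ z₂ c d e - x₄ c d e - (c + d + e - f)
    certificate = solve-∀
    bound : ∀ {u v} → x₄ C D E ≡ u → z₂ C D E ≡ v → C + F ≡ v - u - + 2
    bound x₄≡u z₂≡v = trans (certificate C D E F) (cong₃ (λ u v w → v - u - w) x₄≡u z₂≡v a-f≡2)
    2d+5c≡z₂-2x₄ : ∀ c d e → + 2 * d + + 5 * c ≡ z₂ c d e - x₄ c d e - x₄ c d e
    2d+5c≡z₂-2x₄ = solve-∀
    x₄z₂-units : IsUnit (x₄ C D E) → IsUnit (z₂ C D E) → ⊥
    x₄z₂-units (inj₁ x₄≡1) (inj₁ z₂≡1) = +≢-[1+] (bound x₄≡1 z₂≡1)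
    x₄z₂-units (inj₁ x₄≡1) (inj₂ z₂≡-1) = +≢-[1+] (bound x₄≡1 z₂≡-1)
    x₄z₂-units (inj₂ x₄≡-1) (inj₂ z₂≡-1) = +≢-[1+] (bound x₄≡-1 z₂≡-1)
    x₄z₂-units (inj₂ x₄≡-1) (inj₁ z₂≡1) = ≢-affine (+ 2) D (+ 0)
      (subst (λ c → + 2 * D + + 5 * + c ≡ + 3) (ℕ.m+n≡0⇒m≡0 c (ℤ.+-injective (bound x₄≡-1 z₂≡1)))
        (trans (2d+5c≡z₂-2x₄ C D E) (cong₂ (λ z x → z - x - x) z₂≡1 x₄≡-1)))

  solution-from-gaps : ¬ Imprimitive C D E → M C D E ≢ + 2 → M C D E ≢ + 3 → M C D E ≢ + 14 →
                       Solution (M C D E)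
  solution-from-gaps prim ≢2 ≢3 ≢14 with + 3 ∣ₛ? x₁ C D E
  ... | no 3∤x₁ = solution-3∤x₁ 3∤x₁ ≢3
  ... | yes 3∣x₁ with + 3 ∣ₛ? x₄ C D E
  ...   | yes 3∣x₄ = solution-3∣x₁-3∣x₄ 3∣x₁ 3∣x₄
            (λ 3∣x₂ → prim (imprimitive₁₂₄ C D E 3∣x₁ 3∣x₂ 3∣x₄))
            (λ 3∣x₃ → prim (imprimitive₁₃₄ C D E 3∣x₁ 3∣x₃ 3∣x₄)) ≢2 ≢14
  ...   | no 3∤x₄ with + 3 ∣ₛ? x₃ C D E
  ...     | no 3∤x₃ = solution-3∣x₁-3∤x₄-3∤x₃ 3∣x₁ 3∤x₄ 3∤x₃ ≢2
  ...     | yes 3∣x₃ = solution-3∤x₄-3∤x₂ 3∤x₄ (λ 3∣x₂ → prim (imprimitive₁₂₃ C D E 3∣x₁ 3∣x₂ 3∣x₃))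

sort₃ : (P : ℕ → ℕ → ℕ → Set) → (∀ {x y z} → P x y z → P y x z) → (∀ {x y z} → P x y z → P x z y) →
        ∀ {x y z} → P x y z → ∃[ a ] ∃[ b ] ∃[ c ] c ℕ.≤ b × b ℕ.≤ a × P a b c
sort₃ P swap₁₂ swap₂₃ {x} {y} p = [ insert p , insert (swap₁₂ p) ]′ (ℕ.≤-total y x)
  where
  insert : ∀ {a b c} → P a b c → b ℕ.≤ a → ∃[ a ] ∃[ b ] ∃[ c ] c ℕ.≤ b × b ℕ.≤ a × P a b c
  insert {a} {b} {c} p b≤a with ℕ.≤-total c b | ℕ.≤-total c a
  ... | inj₁ c≤b | _ = a , b , c , c≤b , b≤a , p
  ... | inj₂ b≤c | inj₁ c≤a = a , c , b , b≤c , c≤a , swap₂₃ p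
  ... | inj₂ b≤c | inj₂ a≤c = c , a , b , b≤a , a≤c , swap₁₂ (swap₂₃ p)

Exceptional : ℕ → Set
Exceptional n = n ≡ 1 ⊎ n ≡ 2 ⊎ n ≡ 3 ⊎ n ≡ 14

exceptional? : ∀ n → Dec (Exceptional n)
exceptional? n = n ℕ.≟ 1 ⊎-dec n ℕ.≟ 2 ⊎-dec n ℕ.≟ 3 ⊎-dec n ℕ.≟ 14

nine-times-exceptional : ∀ {n} → Exceptional n → Solution (+ (9 ℕ.* n))
nine-times-exceptional (inj₁ refl) = + 7 , + 4 , + 4 , refl , from-no (3 ℕ.∣? 112) , λ ()
nine-times-exceptional (inj₂ (inj₁ refl)) = + 8 , + 7 , + 7 , refl , from-no (3 ℕ.∣? 392) , λ ()
nine-times-exceptional (inj₂ (inj₂ (inj₁ refl))) =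
  + 13 , + 7 , + 5 , refl , from-no (3 ℕ.∣? 455) , λ ()
nine-times-exceptional (inj₂ (inj₂ (inj₂ refl))) =
  + 22 , + 19 , + 17 , refl , from-no (3 ℕ.∣? 7106) , λ ()

SumOfSquares : ℕ → ℕ → ℕ → ℕ → Set
SumOfSquares n x y z = x ℕ.* x ℕ.+ y ℕ.* y ℕ.+ z ℕ.* z ≡ n

Primitive : ℕ → ℕ → ℕ → Set
Primitive x y z = ¬ (3 ℕ.∣ x × 3 ℕ.∣ y × 3 ℕ.∣ z)

pos-sumOfSquares : ∀ x y z → + (x ℕ.* x ℕ.+ y ℕ.* y ℕ.+ z ℕ.* z) ≡ + x * + x + + y * + y + + z * + z
pos-sumOfSquares x y z = trans (ℤ.pos-+ (x ℕ.* x ℕ.+ y ℕ.* y) (z ℕ.* z))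
  (cong₂ _+_ (trans (ℤ.pos-+ (x ℕ.* x) (y ℕ.* y)) (cong₂ _+_ (ℤ.pos-* x x) (ℤ.pos-* y y)))
    (ℤ.pos-* z z))

∣i∣*∣i∣≡i*i : ∀ i → + ∣ i ∣ * + ∣ i ∣ ≡ i * i
∣i∣*∣i∣≡i*i (+ n) = refl
∣i∣*∣i∣≡i*i -[1+ n ] = refl

sumOfSquares-∣∣ : ∀ {n} x y z → + n ≡ x * x + y * y + z * z → SumOfSquares n (∣ x ∣) (∣ y ∣) (∣ z ∣)
sumOfSquares-∣∣ x y z n≡ = ℤ.+-injective (trans (pos-sumOfSquares (∣ x ∣) (∣ y ∣) (∣ z ∣))
  (trans (cong₃ (λ u v w → u + v + w) (∣i∣*∣i∣≡i*i x) (∣i∣*∣i∣≡i*i y) (∣i∣*∣i∣≡i*i z)) (sym n≡)))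

primitive-of-solution : ∀ n → Solution (+ n) →
                        ∃[ x ] ∃[ y ] ∃[ z ] SumOfSquares (9 ℕ.* n) x y z × Primitive x y z
primitive-of-solution n (x , y , z , sum≡9n , 3∤xyz , _) =
  ∣ x ∣ , ∣ y ∣ , ∣ z ∣ , sumOfSquares-∣∣ x y z (trans (ℤ.pos-* 9 n) (sym sum≡9n)) ,
  λ (3∣x , _ , _) → 3∤xyz
    (Signed.∣⇒∣ᵤ (Signed.∣m⇒∣m*n z (Signed.∣m⇒∣m*n y (Signed.∣ᵤ⇒∣ {+ 3} {x} 3∣x))))

sorted-solution : ∀ {n} a b c → n ≢ 0 → ¬ Exceptional n → c ℕ.≤ b → b ℕ.≤ a →
                  SumOfSquares n a b c → Primitive a b c → Solution (+ n)
sorted-solution 0 0 0 n≢0 _ ℕ.z≤n ℕ.z≤n refl _ = ⊥-elim (n≢0 refl)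
sorted-solution 1 0 0 _ ¬exc ℕ.z≤n ℕ.z≤n refl _ = ⊥-elim (¬exc (inj₁ refl))
sorted-solution 1 1 0 _ ¬exc ℕ.z≤n (ℕ.s≤s ℕ.z≤n) refl _ = ⊥-elim (¬exc (inj₂ (inj₁ refl)))
sorted-solution 1 1 1 _ ¬exc (ℕ.s≤s ℕ.z≤n) (ℕ.s≤s ℕ.z≤n) refl _ =
  ⊥-elim (¬exc (inj₂ (inj₂ (inj₁ refl))))
sorted-solution {n} a@(suc (suc f)) b c _ ¬exc c≤b b≤a sum prim =
  subst Solution M≡n
    (solution-from-gaps c+d+e≡a ¬imprimitive (≢ (inj₂ ∘ inj₁)) (≢ (inj₂ ∘ inj₂ ∘ inj₁))
      (≢ (inj₂ ∘ inj₂ ∘ inj₂)))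
  where
  d e : ℕ
  d = b ℕ.∸ c
  e = a ℕ.∸ b
  c+d≡b : c ℕ.+ d ≡ b
  c+d≡b = ℕ.m+[n∸m]≡n c≤b
  c+d+e≡a : c ℕ.+ d ℕ.+ e ≡ a
  c+d+e≡a = trans (cong (ℕ._+ e) c+d≡b) (ℕ.m+[n∸m]≡n b≤a)
  M≡n : M (+ c) (+ d) (+ e) ≡ + n
  M≡n = trans (cong₂ (λ a b → + a * + a + + b * + b + + c * + c) c+d+e≡a c+d≡b)
              (trans (sym (pos-sumOfSquares a b c)) (cong +_ sum))
  ¬imprimitive : ¬ Imprimitive (+ c) (+ d) (+ e)
  ¬imprimitive (3∣a , 3∣b , 3∣c) = prim
    (subst (3 ℕ.∣_) c+d+e≡a (Signed.∣⇒∣ᵤ 3∣a) , subst (3 ℕ.∣_) c+d≡b (Signed.∣⇒∣ᵤ 3∣b) ,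
     Signed.∣⇒∣ᵤ 3∣c)
  ≢ : ∀ {k} → (n ≡ k → Exceptional n) → M (+ c) (+ d) (+ e) ≢ + k
  ≢ exceptional M≡k = ¬exc (exceptional (ℤ.+-injective (trans (sym M≡n) M≡k)))

primitive-solution : ∀ {n x y z} → n ≢ 0 → ¬ Exceptional n →
                     SumOfSquares n x y z → Primitive x y z → Solution (+ n)
primitive-solution {n} n≢0 ¬exc sum prim
  with sort₃ (λ x y z → SumOfSquares n x y z × Primitive x y z) swap₁₂ swap₂₃ (sum , prim)
  where
  swap₁₂ : ∀ {x y z} → SumOfSquares n x y z × Primitive x y z → SumOfSquares n y x z × Primitive y x z
  swap₁₂ {x} {y} {z} (sum , prim) = trans (reorder x y z) sum , λ (p , q , r) → prim (q , p , r)
    where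
    reorder : ∀ x y z → y ℕ.* y ℕ.+ x ℕ.* x ℕ.+ z ℕ.* z ≡ x ℕ.* x ℕ.+ y ℕ.* y ℕ.+ z ℕ.* z
    reorder = ℕ-solve-∀
  swap₂₃ : ∀ {x y z} → SumOfSquares n x y z × Primitive x y z → SumOfSquares n x z y × Primitive x z y
  swap₂₃ {x} {y} {z} (sum , prim) = trans (reorder x y z) sum , λ (p , q , r) → prim (p , r , q)
    where
    reorder : ∀ x y z → x ℕ.* x ℕ.+ z ℕ.* z ℕ.+ y ℕ.* y ≡ x ℕ.* x ℕ.+ y ℕ.* y ℕ.+ z ℕ.* z
    reorder = ℕ-solve-∀
... | a , b , c , c≤b , b≤a , sum′ , prim′ = sorted-solution a b c n≢0 ¬exc c≤b b≤a sum′ prim′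

solution-of-sumOfSquares : ∀ n → n ≢ 0 → ¬ Exceptional n →
                           ∀ {x y z} → SumOfSquares n x y z → Solution (+ n)
solution-of-sumOfSquares = <-rec _ descent
  where
  descent : ∀ n →
            (∀ {m} → m ℕ.< n → m ≢ 0 → ¬ Exceptional m → ∀ {x y z} → SumOfSquares m x y z →
             Solution (+ m)) →
            n ≢ 0 → ¬ Exceptional n → ∀ {x y z} → SumOfSquares n x y z → Solution (+ n)
  descent n smaller n≢0 ¬exc {x} {y} {z} sum with 3 ℕ.∣? x ×-dec 3 ℕ.∣? y ×-dec 3 ℕ.∣? z
  ... | no prim = primitive-solution n≢0 ¬exc sum prim
  ... | yes (ℕ.divides x′ refl , ℕ.divides y′ refl , ℕ.divides z′ refl) =
    by-exceptionality (exceptional? n′)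
    where
    n′ : ℕ
    n′ = x′ ℕ.* x′ ℕ.+ y′ ℕ.* y′ ℕ.+ z′ ℕ.* z′
    scale : ∀ x y z → x ℕ.* 3 ℕ.* (x ℕ.* 3) ℕ.+ y ℕ.* 3 ℕ.* (y ℕ.* 3) ℕ.+ z ℕ.* 3 ℕ.* (z ℕ.* 3)
                      ≡ 9 ℕ.* (x ℕ.* x ℕ.+ y ℕ.* y ℕ.+ z ℕ.* z)
    scale = ℕ-solve-∀
    n≡9n′ : n ≡ 9 ℕ.* n′
    n≡9n′ = trans (sym sum) (scale x′ y′ z′)
    n′≢0 : n′ ≢ 0
    n′≢0 n′≡0 = n≢0 (trans n≡9n′ (cong (9 ℕ.*_) n′≡0))
    n′<n : n′ ℕ.< n
    n′<n = subst (n′ ℕ.<_) (trans (ℕ.*-comm n′ 9) (sym n≡9n′))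
             (ℕ.m<m*n n′ 9 {{ℕ.≢-nonZero n′≢0}} (ℕ.s≤s (ℕ.s≤s ℕ.z≤n)))
    lift : Solution (+ n′) → Solution (+ n)
    lift solution′ with primitive-of-solution n′ solution′
    ... | _ , _ , _ , sum′ , prim′ = primitive-solution n≢0 ¬exc (trans sum′ (sym n≡9n′)) prim′
    by-exceptionality : Dec (Exceptional n′) → Solution (+ n)
    by-exceptionality (yes exc) = subst (Solution ∘ +_) (sym n≡9n′) (nine-times-exceptional exc)
    by-exceptionality (no ¬exc′) = lift (smaller n′<n n′≢0 ¬exc′ {x′} {y′} {z′} refl)

theorem4p2 : (m : ℤ) → + 0 < m →
    (∃[ a ] ∃[ b ] ∃[ c ] m ≡ a * a + b * b + c * c) →
    m ≢ + 1 → m ≢ + 2 → m ≢ + 3 → m ≢ + 14 →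
    ∃[ x ] ∃[ y ] ∃[ z ]
      (x * x + y * y + z * z ≡ + 9 * m)
      × ¬ (+ 3 ∣ x * y * z)
      × ((x * x - + 1) * (y * y - + 1) * (z * z - + 1) ≢ + 0)
theorem4p2 -[1+ _ ] ()
theorem4p2 (+ n) 0<n (a , b , c , n≡) ≢1 ≢2 ≢3 ≢14 =
  solution-of-sumOfSquares n n≢0 ¬exceptional {∣ a ∣} {∣ b ∣} {∣ c ∣} (sumOfSquares-∣∣ a b c n≡)
  where
  n≢0 : n ≢ 0
  n≢0 refl = ℤ.<-irrefl refl 0<n
  ¬exceptional : ¬ Exceptional n
  ¬exceptional (inj₁ refl) = ≢1 refl
  ¬exceptional (inj₂ (inj₁ refl)) = ≢2 refl
  ¬exceptional (inj₂ (inj₂ (inj₁ refl))) = ≢3 refl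
  ¬exceptional (inj₂ (inj₂ (inj₂ refl))) = ≢14 refl
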